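{- Let $n\geq2$ be even and not a multiple of $6$. Then the inverse of $[1+X+X^2]$ in $\mathbb{F}_2[X]/(X^n+X^{n/2})$ is $$[1+X+X^2]^{ -1}=\begin{cases}[1+XP_{3k}(X)+X^2P_{6k}(X)] & \text{if } n=6k+2,\\ [1+X^2P_{3k}(X)+XP_{6k+3}(X)] & \text{if } n=6k+4,\end{cases}$$ where $k\geq0$ is an integer.
   Context: $P_0(X)=0$, and for $j\geq1$, $P_{3j}(X)=\frac{1+X^{3j}}{1+X+X^2}=(1+X)(1+X^3+\cdots+X^{3(j-1)})\in\mathbb{F}_2[X]$; $[g]$ denotes the residue class of $g$. -}

module Defs where

open import Data.Bool using (Bool; true; false; _xor_; if_then_else_)
open import Data.List using (List; []; _∷_; replicate; _++_)
open import Data.Nat using (ℕ; zero; suc; _*_)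
open import Data.Product using (∃)
open import Relation.Binary.PropositionalEquality using (_≡_)

-- Polynomials over 𝔽₂ = Bool (xor as +, ∧ as *), represented by their
-- coefficient lists, lowest degree first. Trailing zeros are allowed;
-- equality of polynomials is coefficientwise (_≈ₚ_).
Poly : Set
Poly = List Bool

coeff : Poly → ℕ → Bool
coeff []      _       = false
coeff (a ∷ p) zero    = a
coeff (a ∷ p) (suc i) = coeff p i

infixl 6 _+ₚ_
infixl 7 _*ₚ_

_+ₚ_ : Poly → Poly → Poly
[]      +ₚ q       = q
(a ∷ p) +ₚ []      = a ∷ p
(a ∷ p) +ₚ (b ∷ q) = (a xor b) ∷ (p +ₚ q)

_*ₚ_ : Poly → Poly → Poly
[]      *ₚ q = []
(a ∷ p) *ₚ q = (if a then q else []) +ₚ (false ∷ (p *ₚ q))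

0ₚ : Poly
0ₚ = []

1ₚ : Poly
1ₚ = true ∷ []

X^ : ℕ → Poly
X^ i = replicate i false ++ (true ∷ [])

Xₚ : Poly
Xₚ = X^ 1

_≈ₚ_ : Poly → Poly → Set
p ≈ₚ q = ∀ i → coeff p i ≡ coeff q i

-- [f] = [g] in 𝔽₂[X]/(m) : m divides f - g (= f + g in characteristic 2)
_≡_[mod_] : Poly → Poly → Poly → Set
f ≡ g [mod m ] = ∃ λ (q : Poly) → (f +ₚ g) ≈ₚ (q *ₚ m)

IsInverseMod : Poly → Poly → Poly → Set
IsInverseMod m f g = ((f *ₚ g) ≡ 1ₚ [mod m ]) 

geom3 : ℕ → Poly
geom3 zero    = 0ₚ
geom3 (suc j) = geom3 j +ₚ X^ (3 * j)

-- P3 j is P_{3j}: P_0 = 0, P_{3j} = (1+X)(1+X^3+...+X^{3(j-1)}) for j ≥ 1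
P3 : ℕ → Poly
P3 zero    = 0ₚ
P3 (suc j) = (1ₚ +ₚ Xₚ) *ₚ geom3 (suc j)

onePlusXPlusX² : Poly
onePlusXPlusX² = 1ₚ +ₚ Xₚ +ₚ X^ 2

{-# OPTIONS --safe #-}
module Submission where

-- (1 + X + X²)(1 + X) = 1 + X³ over 𝔽₂, so telescoping the geometric sum gives
-- (1 + X + X²) P_{3j} = 1 + X^{3j}.  For n = 6k + 2 the claimed inverse g thus satisfies
-- (1 + X + X²) g = (1 + X + X²) + X (1 + X^{3k}) + X² (1 + X^{6k}) = 1 + X^{n/2} + X^n,
-- which is 1 modulo X^n + X^{n/2}; for n = 6k + 4 the roles of X and X² are exchanged.

open import Defs
open import Data.Nat using (ℕ; _+_; _*_; _≤_; _/_)
open import Data.Nat.Divisibility using (_∣_)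
open import Data.Product using (_×_)
open import Relation.Nullary using (¬_)
open import Relation.Binary.PropositionalEquality using (_≡_)

open import Algebra using (CommutativeRing; CommutativeMonoid)
open import Algebra.Solver.Ring.AlmostCommutativeRing using (AlmostCommutativeRing; _-Raw-AlmostCommutative⟶_; Induced-equivalence)
open import Data.Bool using (Bool; true; false; _xor_; if_then_else_)
open import Data.Bool.Properties using (xor-assoc; xor-comm; xor-identityʳ; xor-∧-commutativeRing)
open import Data.List using ([]; _∷_)
open import Data.Maybe using (just; nothing)
open import Data.Nat using (zero; suc)
open import Data.Nat.DivMod using (m*n/n≡m)
open import Data.Nat.Properties using (*-suc)
open import Data.Nat.Tactic.RingSolver using (solve-∀)
open import Data.Product using (_,_)
open import Function using (id)
open import Level using (0ℓ)
open import Relation.Binary using (IsEquivalence; Setoid; WeaklyDecidable)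
open import Relation.Binary.PropositionalEquality using (refl; sym; trans; cong; cong₂)

-- Coefficientwise equality, wrapped in a record so that Agda can infer the
-- polynomials it relates (coeff is not injective).
infix 4 _≈_

record _≈_ (p q : Poly) : Set where
  constructor coeffwise
  field coeff-≡ : p ≈ₚ q

open _≈_

≈-refl : ∀ {p} → p ≈ p
≈-refl = coeffwise λ _ → refl

≈-isEquivalence : IsEquivalence _≈_
≈-isEquivalence = record
  { refl  = ≈-refl
  ; sym   = λ p≈q → coeffwise λ i → sym (coeff-≡ p≈q i)
  ; trans = λ p≈q q≈r → coeffwise λ i → trans (coeff-≡ p≈q i) (coeff-≡ q≈r i)
  }

≈-setoid : Setoid 0ℓ 0ℓ
≈-setoid = record { isEquivalence = ≈-isEquivalence }

open IsEquivalence ≈-isEquivalence using () renaming (sym to ≈-sym; trans to ≈-trans)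

open import Algebra.Definitions _≈_ using (Congruent₂; LeftCongruent; Associative; Commutative; LeftIdentity; RightIdentity; RightZero; _DistributesOverˡ_; _DistributesOverʳ_)
open import Algebra.Structures _≈_ using (IsCommutativeMonoid)
open import Algebra.Structures.Biased _≈_ using (IsCommutativeSemiringʳ)
open import Relation.Binary.Reasoning.Setoid ≈-setoid

∷-cong : ∀ {a b p q} → a ≡ b → p ≈ q → a ∷ p ≈ b ∷ q
∷-cong a≡b p≈q = coeffwise λ { zero → a≡b ; (suc i) → coeff-≡ p≈q i }

false∷-zero : ∀ {p} → p ≈ 0ₚ → false ∷ p ≈ 0ₚ
false∷-zero p≈0 = coeffwise λ { zero → refl ; (suc i) → coeff-≡ p≈0 i }

coeff-+ₚ : ∀ p q i → coeff (p +ₚ q) i ≡ coeff p i xor coeff q i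
coeff-+ₚ []      q       i       = refl
coeff-+ₚ (a ∷ p) []      i       = sym (xor-identityʳ (coeff (a ∷ p) i))
coeff-+ₚ (a ∷ p) (b ∷ q) zero    = refl
coeff-+ₚ (a ∷ p) (b ∷ q) (suc i) = coeff-+ₚ p q i

+ₚ-cong : Congruent₂ _+ₚ_
+ₚ-cong {p} {p′} {q} {q′} p≈p′ q≈q′ = coeffwise λ i →
  trans (coeff-+ₚ p q i) (trans (cong₂ _xor_ (coeff-≡ p≈p′ i) (coeff-≡ q≈q′ i)) (sym (coeff-+ₚ p′ q′ i)))

+ₚ-assoc : Associative _+ₚ_
+ₚ-assoc []      q       r       = ≈-refl
+ₚ-assoc (a ∷ p) []      r       = ≈-refl
+ₚ-assoc (a ∷ p) (b ∷ q) []      = ≈-refl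
+ₚ-assoc (a ∷ p) (b ∷ q) (c ∷ r) = ∷-cong (xor-assoc a b c) (+ₚ-assoc p q r)

+ₚ-comm : Commutative _+ₚ_
+ₚ-comm []      []      = ≈-refl
+ₚ-comm []      (b ∷ q) = ≈-refl
+ₚ-comm (a ∷ p) []      = ≈-refl
+ₚ-comm (a ∷ p) (b ∷ q) = ∷-cong (xor-comm a b) (+ₚ-comm p q)

+ₚ-identityʳ : RightIdentity 0ₚ _+ₚ_
+ₚ-identityʳ []      = ≈-refl
+ₚ-identityʳ (a ∷ p) = ≈-refl

+ₚ-isCommutativeMonoid : IsCommutativeMonoid _+ₚ_ 0ₚ
+ₚ-isCommutativeMonoid = record
  { isMonoid = record
    { isSemigroup = record
      { isMagma = record { isEquivalence = ≈-isEquivalence ; ∙-cong = +ₚ-cong }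
      ; assoc   = +ₚ-assoc
      }
    ; identity = (λ _ → ≈-refl) , +ₚ-identityʳ
    }
  ; comm = +ₚ-comm
  }

+ₚ-commutativeMonoid : CommutativeMonoid 0ℓ 0ℓ
+ₚ-commutativeMonoid = record { isCommutativeMonoid = +ₚ-isCommutativeMonoid }

open import Algebra.Properties.CommutativeSemigroup (CommutativeMonoid.commutativeSemigroup +ₚ-commutativeMonoid) using (interchange)

-- With this, (a ∷ p) *ₚ q unfolds to a ·ₚ q +ₚ (false ∷ p *ₚ q), that is a q + X (p q).
infixr 7 _·ₚ_

_·ₚ_ : Bool → Poly → Poly
a ·ₚ q = if a then q else 0ₚ

·ₚ-congˡ : ∀ a {q r} → q ≈ r → a ·ₚ q ≈ a ·ₚ r
·ₚ-congˡ true  q≈r = q≈r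
·ₚ-congˡ false q≈r = ≈-refl

*ₚ-congˡ : LeftCongruent _*ₚ_
*ₚ-congˡ {[]}    q≈r = ≈-refl
*ₚ-congˡ {a ∷ p} q≈r = +ₚ-cong (·ₚ-congˡ a q≈r) (∷-cong refl (*ₚ-congˡ {p} q≈r))

·ₚ-distribˡ : ∀ a q r → a ·ₚ (q +ₚ r) ≈ a ·ₚ q +ₚ a ·ₚ r
·ₚ-distribˡ true  q r = ≈-refl
·ₚ-distribˡ false q r = ≈-refl

·ₚ-*ₚ-assoc : ∀ a q r → (a ·ₚ q) *ₚ r ≈ a ·ₚ (q *ₚ r)
·ₚ-*ₚ-assoc true  q r = ≈-refl
·ₚ-*ₚ-assoc false q r = ≈-refl

*ₚ-zeroʳ : RightZero 0ₚ _*ₚ_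
*ₚ-zeroʳ []          = ≈-refl
*ₚ-zeroʳ (true  ∷ p) = false∷-zero (*ₚ-zeroʳ p)
*ₚ-zeroʳ (false ∷ p) = false∷-zero (*ₚ-zeroʳ p)

*ₚ-distribˡ : _*ₚ_ DistributesOverˡ _+ₚ_
*ₚ-distribˡ []      q r = ≈-refl
*ₚ-distribˡ (a ∷ p) q r = begin
  a ·ₚ (q +ₚ r) +ₚ (false ∷ p *ₚ (q +ₚ r))
    ≈⟨ +ₚ-cong (·ₚ-distribˡ a q r) (∷-cong refl (*ₚ-distribˡ p q r)) ⟩
  (a ·ₚ q +ₚ a ·ₚ r) +ₚ ((false ∷ p *ₚ q) +ₚ (false ∷ p *ₚ r))
    ≈⟨ interchange (a ·ₚ q) (a ·ₚ r) (false ∷ p *ₚ q) (false ∷ p *ₚ r) ⟩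
  (a ·ₚ q +ₚ (false ∷ p *ₚ q)) +ₚ (a ·ₚ r +ₚ (false ∷ p *ₚ r)) ∎

*ₚ-shiftʳ : ∀ p q → p *ₚ (false ∷ q) ≈ false ∷ p *ₚ q
*ₚ-shiftʳ []          q = ≈-sym (false∷-zero ≈-refl)
*ₚ-shiftʳ (true  ∷ p) q = ∷-cong refl (+ₚ-cong ≈-refl (*ₚ-shiftʳ p q))
*ₚ-shiftʳ (false ∷ p) q = ∷-cong refl (*ₚ-shiftʳ p q)

*ₚ-constʳ : ∀ p a → p *ₚ (a ∷ []) ≈ a ·ₚ p
*ₚ-constʳ []          true  = ≈-refl
*ₚ-constʳ []          false = ≈-refl
*ₚ-constʳ (true  ∷ p) true  = ∷-cong refl (*ₚ-constʳ p true)
*ₚ-constʳ (false ∷ p) true  = ∷-cong refl (*ₚ-constʳ p true)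
*ₚ-constʳ (true  ∷ p) false = false∷-zero (*ₚ-constʳ p false)
*ₚ-constʳ (false ∷ p) false = false∷-zero (*ₚ-constʳ p false)

*ₚ-comm : Commutative _*ₚ_
*ₚ-comm []      q = ≈-sym (*ₚ-zeroʳ q)
*ₚ-comm (a ∷ p) q = begin
  a ·ₚ q +ₚ (false ∷ p *ₚ q)
    ≈⟨ +ₚ-cong (≈-sym (*ₚ-constʳ q a)) (∷-cong refl (*ₚ-comm p q)) ⟩
  q *ₚ (a ∷ []) +ₚ (false ∷ q *ₚ p)
    ≈⟨ +ₚ-cong ≈-refl (≈-sym (*ₚ-shiftʳ q p)) ⟩
  q *ₚ (a ∷ []) +ₚ q *ₚ (false ∷ p)
    ≈⟨ ≈-sym (*ₚ-distribˡ q (a ∷ []) (false ∷ p)) ⟩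
  q *ₚ ((a xor false) ∷ p)
    ≈⟨ *ₚ-congˡ {q} (∷-cong (xor-identityʳ a) ≈-refl) ⟩
  q *ₚ (a ∷ p) ∎

*ₚ-distribʳ : _*ₚ_ DistributesOverʳ _+ₚ_
*ₚ-distribʳ p q r = begin
  (q +ₚ r) *ₚ p        ≈⟨ *ₚ-comm (q +ₚ r) p ⟩
  p *ₚ (q +ₚ r)        ≈⟨ *ₚ-distribˡ p q r ⟩
  p *ₚ q +ₚ p *ₚ r     ≈⟨ +ₚ-cong (*ₚ-comm p q) (*ₚ-comm p r) ⟩
  q *ₚ p +ₚ r *ₚ p     ∎

*ₚ-assoc : Associative _*ₚ_
*ₚ-assoc []      q r = ≈-refl
*ₚ-assoc (a ∷ p) q r = begin
  (a ·ₚ q +ₚ (false ∷ p *ₚ q)) *ₚ r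
    ≈⟨ *ₚ-distribʳ r (a ·ₚ q) (false ∷ p *ₚ q) ⟩
  (a ·ₚ q) *ₚ r +ₚ (false ∷ (p *ₚ q) *ₚ r)
    ≈⟨ +ₚ-cong (·ₚ-*ₚ-assoc a q r) (∷-cong refl (*ₚ-assoc p q r)) ⟩
  a ·ₚ (q *ₚ r) +ₚ (false ∷ p *ₚ (q *ₚ r)) ∎

*ₚ-identityˡ : LeftIdentity 1ₚ _*ₚ_
*ₚ-identityˡ q = ≈-trans (+ₚ-cong ≈-refl (false∷-zero ≈-refl)) (+ₚ-identityʳ q)

*ₚ-cong : Congruent₂ _*ₚ_
*ₚ-cong {p} {p′} {q} {q′} p≈p′ q≈q′ = begin
  p *ₚ q    ≈⟨ *ₚ-congˡ {p} q≈q′ ⟩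
  p *ₚ q′   ≈⟨ *ₚ-comm p q′ ⟩
  q′ *ₚ p   ≈⟨ *ₚ-congˡ {q′} p≈p′ ⟩
  q′ *ₚ p′  ≈⟨ *ₚ-comm q′ p′ ⟩
  p′ *ₚ q′  ∎

𝔽₂[X] : AlmostCommutativeRing 0ℓ 0ℓ
𝔽₂[X] = record
  { _≈_ = _≈_
  ; _+_ = _+ₚ_
  ; _*_ = _*ₚ_
  ; -_  = id
  ; 0#  = 0ₚ
  ; 1#  = 1ₚ
  ; isAlmostCommutativeRing = record
    { isCommutativeSemiring = IsCommutativeSemiringʳ.isCommutativeSemiring record
      { +-isCommutativeMonoid = +ₚ-isCommutativeMonoid
      ; *-isCommutativeMonoid = record
        { isMonoid = record
          { isSemigroup = record
            { isMagma = record { isEquivalence = ≈-isEquivalence ; ∙-cong = *ₚ-cong }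
            ; assoc   = *ₚ-assoc
            }
          ; identity = *ₚ-identityˡ , λ p → ≈-trans (*ₚ-comm p 1ₚ) (*ₚ-identityˡ p)
          }
        ; comm = *ₚ-comm
        }
      ; distribˡ = *ₚ-distribˡ
      ; zeroʳ    = *ₚ-zeroʳ
      }
    ; -‿cong       = id
    ; -‿*-distribˡ = λ _ _ → ≈-refl
    ; -‿+-comm     = λ _ _ → ≈-refl
    }
  }

-- Coefficients are computed in (Bool, xor, ∧), so the solver knows that 1 + 1 = 0.
𝔽₂-constants : CommutativeRing.rawRing xor-∧-commutativeRing -Raw-AlmostCommutative⟶ 𝔽₂[X]
𝔽₂-constants = record
  { ⟦_⟧    = _∷ []
  ; +-homo = λ _ _ → ≈-refl
  ; *-homo = λ { true b → ∷-cong (sym (xor-identityʳ b)) ≈-refl ; false b → ≈-refl }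
  ; -‿homo = λ _ → ≈-refl
  ; 0-homo = false∷-zero ≈-refl
  ; 1-homo = ≈-refl
  }

𝔽₂-constants-≟ : WeaklyDecidable (Induced-equivalence 𝔽₂-constants)
𝔽₂-constants-≟ true  true  = just ≈-refl
𝔽₂-constants-≟ false false = just ≈-refl
𝔽₂-constants-≟ _     _     = nothing

open import Algebra.Solver.Ring (CommutativeRing.rawRing xor-∧-commutativeRing) 𝔽₂[X] 𝔽₂-constants 𝔽₂-constants-≟ using (solve; _:=_; _:+_; _:*_; con)

X^-+ : ∀ m n → X^ (m + n) ≈ X^ m *ₚ X^ n
X^-+ zero    n = ≈-sym (*ₚ-identityˡ (X^ n))
X^-+ (suc m) n = ∷-cong refl (X^-+ m n)

1+X^0≈0 : 1ₚ +ₚ X^ 0 ≈ 0ₚ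
1+X^0≈0 = false∷-zero ≈-refl

[1+X³]*geom3 : ∀ j → (1ₚ +ₚ X^ 3) *ₚ geom3 j ≈ 1ₚ +ₚ X^ (3 * j)
[1+X³]*geom3 zero    = ≈-trans (*ₚ-zeroʳ (1ₚ +ₚ X^ 3)) (≈-sym 1+X^0≈0)
[1+X³]*geom3 (suc j) = begin
  (1ₚ +ₚ X^ 3) *ₚ (geom3 j +ₚ X^ (3 * j))
    ≈⟨ solve 3 (λ X³ G M → (con true :+ X³) :* (G :+ M) := (con true :+ X³) :* G :+ M :+ X³ :* M)
         ≈-refl (X^ 3) (geom3 j) (X^ (3 * j)) ⟩
  (1ₚ +ₚ X^ 3) *ₚ geom3 j +ₚ X^ (3 * j) +ₚ X^ 3 *ₚ X^ (3 * j)
    ≈⟨ +ₚ-cong (+ₚ-cong ([1+X³]*geom3 j) ≈-refl) (≈-sym (X^-+ 3 (3 * j))) ⟩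
  1ₚ +ₚ X^ (3 * j) +ₚ X^ (3 * j) +ₚ X^ (3 + 3 * j)
    ≈⟨ solve 2 (λ M N → con true :+ M :+ M :+ N := con true :+ N) ≈-refl (X^ (3 * j)) (X^ (3 + 3 * j)) ⟩
  1ₚ +ₚ X^ (3 + 3 * j)
    ≡⟨ cong (λ e → 1ₚ +ₚ X^ e) (sym (*-suc 3 j)) ⟩
  1ₚ +ₚ X^ (3 * suc j) ∎

[1+X+X²]*[1+X] : onePlusXPlusX² *ₚ (1ₚ +ₚ Xₚ) ≈ 1ₚ +ₚ X^ 3
[1+X+X²]*[1+X] = ≈-refl

[1+X+X²]*P3 : ∀ j → onePlusXPlusX² *ₚ P3 j ≈ 1ₚ +ₚ X^ (3 * j)
[1+X+X²]*P3 zero    = ≈-trans (*ₚ-zeroʳ onePlusXPlusX²) (≈-sym 1+X^0≈0)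
[1+X+X²]*P3 (suc j) = begin
  onePlusXPlusX² *ₚ ((1ₚ +ₚ Xₚ) *ₚ geom3 (suc j))  ≈⟨ ≈-sym (*ₚ-assoc onePlusXPlusX² (1ₚ +ₚ Xₚ) (geom3 (suc j))) ⟩
  (onePlusXPlusX² *ₚ (1ₚ +ₚ Xₚ)) *ₚ geom3 (suc j)  ≈⟨ *ₚ-cong [1+X+X²]*[1+X] ≈-refl ⟩
  (1ₚ +ₚ X^ 3) *ₚ geom3 (suc j)                     ≈⟨ [1+X³]*geom3 (suc j) ⟩
  1ₚ +ₚ X^ (3 * suc j)                               ∎

[1+X+X²]*[1+XP+X²Q] : ∀ {P Q} a b → onePlusXPlusX² *ₚ P ≈ 1ₚ +ₚ X^ a → onePlusXPlusX² *ₚ Q ≈ 1ₚ +ₚ X^ b →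
                      onePlusXPlusX² *ₚ (1ₚ +ₚ Xₚ *ₚ P +ₚ X^ 2 *ₚ Q) ≈ 1ₚ +ₚ X^ (1 + a) +ₚ X^ (2 + b)
[1+X+X²]*[1+XP+X²Q] {P} {Q} a b fP≈ fQ≈ = begin
  onePlusXPlusX² *ₚ (1ₚ +ₚ Xₚ *ₚ P +ₚ X^ 2 *ₚ Q)
    ≈⟨ solve 4 (λ X X² P Q → (con true :+ X :+ X²) :* (con true :+ X :* P :+ X² :* Q)
                           := (con true :+ X :+ X²) :+ X :* ((con true :+ X :+ X²) :* P) :+ X² :* ((con true :+ X :+ X²) :* Q))
         ≈-refl Xₚ (X^ 2) P Q ⟩
  onePlusXPlusX² +ₚ Xₚ *ₚ (onePlusXPlusX² *ₚ P) +ₚ X^ 2 *ₚ (onePlusXPlusX² *ₚ Q)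
    ≈⟨ +ₚ-cong (+ₚ-cong (≈-refl {onePlusXPlusX²}) (*ₚ-congˡ {Xₚ} fP≈)) (*ₚ-congˡ {X^ 2} fQ≈) ⟩
  onePlusXPlusX² +ₚ Xₚ *ₚ (1ₚ +ₚ X^ a) +ₚ X^ 2 *ₚ (1ₚ +ₚ X^ b)
    ≈⟨ solve 4 (λ X X² A B → (con true :+ X :+ X²) :+ X :* (con true :+ A) :+ X² :* (con true :+ B)
                           := con true :+ X :* A :+ X² :* B)
         ≈-refl Xₚ (X^ 2) (X^ a) (X^ b) ⟩
  1ₚ +ₚ Xₚ *ₚ X^ a +ₚ X^ 2 *ₚ X^ b
    ≈⟨ +ₚ-cong (+ₚ-cong (≈-refl {1ₚ}) (≈-sym (X^-+ 1 a))) (≈-sym (X^-+ 2 b)) ⟩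
  1ₚ +ₚ X^ (1 + a) +ₚ X^ (2 + b) ∎

*≈1+m⇒IsInverseMod : ∀ m f g → f *ₚ g ≈ 1ₚ +ₚ m → IsInverseMod m f g
*≈1+m⇒IsInverseMod m f g fg≈1+m = 1ₚ , coeff-≡ (begin
  f *ₚ g +ₚ 1ₚ         ≈⟨ +ₚ-cong fg≈1+m ≈-refl ⟩
  1ₚ +ₚ m +ₚ 1ₚ        ≈⟨ solve 1 (λ m → con true :+ m :+ con true := con true :* m) ≈-refl m ⟩
  1ₚ *ₚ m              ∎)

n≡m*2⇒n/2≡m : ∀ {n} m → n ≡ m * 2 → n / 2 ≡ m
n≡m*2⇒n/2≡m m refl = m*n/n≡m m 2

[1+X+X²]⁻¹-6k+2 : ∀ k → IsInverseMod (X^ (6 * k + 2) +ₚ X^ ((6 * k + 2) / 2)) onePlusXPlusX²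
                                     (1ₚ +ₚ Xₚ *ₚ P3 k +ₚ X^ 2 *ₚ P3 (2 * k))
[1+X+X²]⁻¹-6k+2 k = *≈1+m⇒IsInverseMod (X^ n +ₚ X^ (n / 2)) onePlusXPlusX² g (begin
  onePlusXPlusX² *ₚ g
    ≈⟨ [1+X+X²]*[1+XP+X²Q] (3 * k) (3 * (2 * k)) ([1+X+X²]*P3 k) ([1+X+X²]*P3 (2 * k)) ⟩
  1ₚ +ₚ X^ (1 + 3 * k) +ₚ X^ (2 + 3 * (2 * k))
    ≡⟨ cong₂ (λ d e → 1ₚ +ₚ X^ d +ₚ X^ e) (sym (n≡m*2⇒n/2≡m (1 + 3 * k) (n≡ k))) (2+3[2k]≡ k) ⟩
  1ₚ +ₚ X^ (n / 2) +ₚ X^ n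
    ≈⟨ solve 2 (λ A B → con true :+ A :+ B := con true :+ (B :+ A)) ≈-refl (X^ (n / 2)) (X^ n) ⟩
  1ₚ +ₚ (X^ n +ₚ X^ (n / 2)) ∎)
  where
  n : ℕ
  n = 6 * k + 2
  g : Poly
  g = 1ₚ +ₚ Xₚ *ₚ P3 k +ₚ X^ 2 *ₚ P3 (2 * k)
  n≡ : ∀ j → 6 * j + 2 ≡ (1 + 3 * j) * 2
  n≡ = solve-∀
  2+3[2k]≡ : ∀ j → 2 + 3 * (2 * j) ≡ 6 * j + 2
  2+3[2k]≡ = solve-∀

[1+X+X²]⁻¹-6k+4 : ∀ k → IsInverseMod (X^ (6 * k + 4) +ₚ X^ ((6 * k + 4) / 2)) onePlusXPlusX²
                                     (1ₚ +ₚ X^ 2 *ₚ P3 k +ₚ Xₚ *ₚ P3 (2 * k + 1))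
[1+X+X²]⁻¹-6k+4 k = *≈1+m⇒IsInverseMod (X^ n +ₚ X^ (n / 2)) onePlusXPlusX² g (begin
  onePlusXPlusX² *ₚ g
    ≈⟨ *ₚ-congˡ {onePlusXPlusX²} (solve 2 (λ A B → con true :+ A :+ B := con true :+ B :+ A)
                                         ≈-refl (X^ 2 *ₚ P3 k) (Xₚ *ₚ P3 (2 * k + 1))) ⟩
  onePlusXPlusX² *ₚ (1ₚ +ₚ Xₚ *ₚ P3 (2 * k + 1) +ₚ X^ 2 *ₚ P3 k)
    ≈⟨ [1+X+X²]*[1+XP+X²Q] (3 * (2 * k + 1)) (3 * k) ([1+X+X²]*P3 (2 * k + 1)) ([1+X+X²]*P3 k) ⟩
  1ₚ +ₚ X^ (1 + 3 * (2 * k + 1)) +ₚ X^ (2 + 3 * k)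
    ≡⟨ cong₂ (λ d e → 1ₚ +ₚ X^ d +ₚ X^ e) (1+3[2k+1]≡ k) (sym (n≡m*2⇒n/2≡m (2 + 3 * k) (n≡ k))) ⟩
  1ₚ +ₚ X^ n +ₚ X^ (n / 2)
    ≈⟨ +ₚ-assoc 1ₚ (X^ n) (X^ (n / 2)) ⟩
  1ₚ +ₚ (X^ n +ₚ X^ (n / 2)) ∎)
  where
  n : ℕ
  n = 6 * k + 4
  g : Poly
  g = 1ₚ +ₚ X^ 2 *ₚ P3 k +ₚ Xₚ *ₚ P3 (2 * k + 1)
  n≡ : ∀ j → 6 * j + 4 ≡ (2 + 3 * j) * 2
  n≡ = solve-∀
  1+3[2k+1]≡ : ∀ j → 1 + 3 * (2 * j + 1) ≡ 6 * j + 4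
  1+3[2k+1]≡ = solve-∀

lemma19 : (n : ℕ) → 2 ≤ n → 2 ∣ n → ¬ (6 ∣ n) →
          ((k : ℕ) → n ≡ 6 * k + 2 →
            IsInverseMod (X^ n +ₚ X^ (n / 2)) onePlusXPlusX²
              (1ₚ +ₚ Xₚ *ₚ P3 k +ₚ X^ 2 *ₚ P3 (2 * k)))
          × ((k : ℕ) → n ≡ 6 * k + 4 →
            IsInverseMod (X^ n +ₚ X^ (n / 2)) onePlusXPlusX²
              (1ₚ +ₚ X^ 2 *ₚ P3 k +ₚ Xₚ *ₚ P3 (2 * k + 1)))
-- The hypotheses on n only ensure that one of the two cases applies.
lemma19 n _ _ _ = (λ { k refl → [1+X+X²]⁻¹-6k+2 k }) , (λ { k refl → [1+X+X²]⁻¹-6k+4 k })
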